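{- Let $t\ge 3$ and $1\le n_1\le\cdots\le n_t$, and let $K_{n_1,\dots,n_t}$ be the complete $t$-partite graph with class sizes $n_1,\dots,n_t$. Let $m=\sum_{i=1}^{t-1}n_i$ and $n=n_t$. Then (a) $rc^\ell(K_{n_1,\dots,n_t})=1$ if $n_t=1$; $=2$ if $n_t\ge 2$ and $m>n$; and $=\min(\lceil\sqrt[m]{n}\,\rceil,3)$ if $m\le n$; (b) $src^\ell(K_{n_1,\dots,n_t})=1$ if $n_t=1$; $=2$ if $n_t\ge 2$ and $m>n$; and $=\lceil\sqrt[m]{n}\,\rceil$ if $m\le n$.
   Context: An edge-coloured path is rainbow if all its edges have distinct colours; a geodesic is a shortest path between its endpoints. An (not necessarily proper) edge-colouring of a connected graph is rainbow connected (resp. strongly rainbow connected) if any two vertices are joined by a rainbow path (resp. rainbow geodesic). An $r$-edge-list assignment of $G$ assigns to each edge $e$ a set $L(e)\subset\mathbb N$ with $|L(e)|\ge r$; an $L$-edge-colouring is an edge-colouring $c$ with $c(e)\in L(e)$ for all $e$. $rc^\ell(G)$ (resp. $src^\ell(G)$) is the minimum integer $r$ such that for every $r$-edge-list assignment $L$ of $G$ there exists a rainbow connected (resp. strongly rainbow connected) $L$-edge-colouring of $G$. -}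

module Defs where

open import Data.Nat using (ℕ; zero; suc; _+_; _≤_; _<_; _^_; _≤ᵇ_)
open import Data.Bool using (if_then_else_)
open import Data.Fin as F using (Fin)
open import Data.Fin.Properties using (<-cmp)
open import Data.Product using (Σ; _×_; _,_; proj₁; proj₂)
open import Data.List using (List; []; _∷_; map)
open import Data.List.Relation.Unary.Unique.Propositional using (Unique)
open import Relation.Binary.PropositionalEquality using (_≡_; _≢_)
open import Relation.Binary.Definitions using (tri<; tri≈; tri>)
open import Relation.Nullary using (¬_)
open import Data.Empty using (⊥-elim)
open import Function.Definitions using (Injective)

record Graph : Set₁ where
  field
    V    : Set
    Adj  : V → V → Set
    Edge : Set
    edge : {u v : V} → Adj u v → Edge

module _ (G : Graph) where
  open Graph G

  data Walk : V → V → Set where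
    [] : ∀ {u} → Walk u u
    _∷_ : ∀ {u w v} → Adj u w → Walk w v → Walk u v

  vertices : ∀ {u v} → Walk u v → List V
  vertices {u} []      = u ∷ []
  vertices {u} (a ∷ p) = u ∷ vertices p

  edges : ∀ {u v} → Walk u v → List Edge
  edges []      = []
  edges (a ∷ p) = edge a ∷ edges p

  len : ∀ {u v} → Walk u v → ℕ
  len []      = 0
  len (a ∷ p) = suc (len p)

  IsPath : ∀ {u v} → Walk u v → Set
  IsPath p = Unique (vertices p)

  IsGeodesic : ∀ {u v} → Walk u v → Set
  IsGeodesic {u} {v} p = IsPath p × ((q : Walk u v) → IsPath q → len p ≤ len q)

  Colouring : Set
  Colouring = Edge → ℕ

  Rainbow : Colouring → ∀ {u v} → Walk u v → Set
  Rainbow c p = Unique (map c (edges p))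

  RainbowConnected : Colouring → Set
  RainbowConnected c = (u v : V) → Σ (Walk u v) λ p → IsPath p × Rainbow c p

  StronglyRainbowConnected : Colouring → Set
  StronglyRainbowConnected c = (u v : V) → Σ (Walk u v) λ p → IsGeodesic p × Rainbow c p

  EdgeLists : Set₁
  EdgeLists = Edge → ℕ → Set

  -- |A| ≥ r for A ⊆ ℕ : there are r distinct elements of A
  AtLeast : ℕ → (ℕ → Set) → Set
  AtLeast r A = Σ (Fin r → ℕ) λ f → Injective _≡_ _≡_ f × ((i : Fin r) → A (f i))

  IsListAssignment : ℕ → EdgeLists → Set
  IsListAssignment r L = (e : Edge) → AtLeast r (L e)

  IsLColouring : EdgeLists → Colouring → Set
  IsLColouring L c = (e : Edge) → L e (c e)

  ListRC : ℕ → Set₁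
  ListRC r = (L : EdgeLists) → IsListAssignment r L →
             Σ Colouring λ c → IsLColouring L c × RainbowConnected c

  ListSRC : ℕ → Set₁
  ListSRC r = (L : EdgeLists) → IsListAssignment r L →
              Σ Colouring λ c → IsLColouring L c × StronglyRainbowConnected c

IsMinimum : (ℕ → Set₁) → ℕ → Set₁
IsMinimum P k = P k × ((r : ℕ) → r < k → ¬ P r)

rcℓ≡ : Graph → ℕ → Set₁
rcℓ≡ G k = IsMinimum (ListRC G) k

srcℓ≡ : Graph → ℕ → Set₁
srcℓ≡ G k = IsMinimum (ListSRC G) k

-- Edges: (i , j , i<j , a , b), i.e. unordered pairs oriented by class.

MEdge : (t : ℕ) → (Fin t → ℕ) → Set
MEdge t ns = Σ (Fin t) λ i → Σ (Fin t) λ j → (i F.< j) × Fin (ns i) × Fin (ns j)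

MVertex : (t : ℕ) → (Fin t → ℕ) → Set
MVertex t ns = Σ (Fin t) λ i → Fin (ns i)

medge : (t : ℕ) (ns : Fin t → ℕ) (u v : MVertex t ns) → proj₁ u ≢ proj₁ v → MEdge t ns
medge t ns (i , a) (j , b) i≢j with <-cmp i j
... | tri< i<j _ _ = i , j , i<j , a , b
... | tri≈ _ i≡j _ = ⊥-elim (i≢j i≡j)
... | tri> _ _ j<i = j , i , j<i , b , a

CompleteMultipartite : (t : ℕ) → (Fin t → ℕ) → Graph
CompleteMultipartite t ns = record
  { V    = MVertex t ns
  ; Adj  = λ u v → proj₁ u ≢ proj₁ v
  ; Edge = MEdge t ns
  ; edge = λ {u} {v} a → medge t ns u v a
  }

sumFin : (k : ℕ) → (Fin k → ℕ) → ℕ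
sumFin zero    f = 0
sumFin (suc k) f = f F.zero + sumFin k (λ i → f (F.suc i))

-- ⌈ n^(1/m) ⌉ = least k with n ≤ k ^ m (linear search, k = n always works
-- when m ≥ 1)
private
  search : ℕ → ℕ → ℕ → ℕ → ℕ
  search m n zero       k = k
  search m n (suc fuel) k = if n ≤ᵇ k ^ m then k else search m n fuel (suc k)

ceilRoot : ℕ → ℕ → ℕ
ceilRoot m n = search m n n 0

{-# OPTIONS --safe #-}

-- Let X be the largest class (n vertices) and W the union of the other
-- classes (m vertices). Distinct non-adjacent vertices lie in one class and
-- have distance 2, through W for two vertices of X and through X for two
-- vertices of a class of W. So a colouring of the X–W edges, read as an
-- X × W matrix, is strongly rainbow connected as soon as its rows are
-- pairwise distinct and its columns are distinct within each class of W;
-- from lists of size r such a matrix is built greedily, a row or a column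
-- at a time, whenever n ≤ r ^ m. Conversely, colours from {0, …, r - 1} with
-- r ^ m < n force two equal rows, whose vertices then have no rainbow
-- geodesic, and no rainbow path at all if r ≤ 2. Three colours always give
-- rainbow connection when m ≤ n: only m rows need to be distinct, and every
-- other vertex x is joined to the rest of X by a rainbow path x α β y through
-- two fixed vertices α, β of W.
module Submission where

open import Defs
open import Data.Nat
open import Data.Nat.Properties
open import Data.Bool using (true; false; T)
open import Data.Unit using (tt)
open import Data.Sum using (_⊎_; inj₁; inj₂)
open import Data.Product using (Σ; ∃; ∃₂; _×_; _,_; proj₁; proj₂)
open import Data.Fin as F using (Fin; toℕ; fromℕ; fromℕ<; inject₁; inject≤; _↑ˡ_; _↑ʳ_; splitAt; finToFun; funToFin)
import Data.Fin.Properties as FP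
open import Data.List.Relation.Unary.All using () renaming ([] to []ᴬ; _∷_ to _∷ᴬ_)
open import Data.List.Relation.Unary.AllPairs using () renaming ([] to []ᴾ; _∷_ to _∷ᴾ_)
open import Function using (_∘_)
open import Function.Definitions using (Injective)
open import Relation.Nullary using (¬_; Dec; yes; no)
open import Relation.Binary.Definitions using (tri<; tri≈; tri>)
open import Data.Empty using (⊥; ⊥-elim)
open import Relation.Binary.PropositionalEquality

n<r^n : ∀ {r} → 1 < r → ∀ n → n < r ^ n
n<r^n 1<r zero = s≤s z≤n
n<r^n {r} 1<r (suc n) = ≤-<-trans (n<r^n 1<r n) (^-monoʳ-< r 1<r (n<1+n n))

n≤n^m : ∀ n {m} → 1 ≤ m → n ≤ n ^ m
n≤n^m zero    _ = z≤n
n≤n^m (suc n) {suc m} _ = m≤m*n (suc n) (suc n ^ m) {{>-nonZero (m^n>0 (suc n) m)}}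

0^m<n : ∀ {m n} → 1 ≤ m → 1 ≤ n → 0 ^ m < n
0^m<n {suc m} _ 1≤n = 1≤n

r^m≤1 : ∀ {r} m → r ≤ 1 → r ^ m ≤ 1
r^m≤1 {r} m r≤1 = ≤-trans (^-monoˡ-≤ m r≤1) (≤-reflexive (^-zeroˡ m))

-- Ceiling of the m-th root

IsCeilRoot : ℕ → ℕ → ℕ → Set
IsCeilRoot m n q = n ≤ q ^ m × (∀ r → r < q → r ^ m < n)

-- `search`, the private worker of `ceilRoot` in Defs, is recovered by
-- unification: the `with` turns its arguments into variables, so the
-- meta `search` is solved by a pattern.
mutual
  search : ℕ → ℕ → ℕ → ℕ → ℕ
  search = _

  search-determined : ∀ m n → ceilRoot m (suc n) ≡ ceilRoot m (suc n)
  search-determined m n with suc n | 1 | n <ᵇ 0 ^ m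
  ... | _ | _ | true  = refl
  ... | N | k | false = refl {x = search m N n k}

search-isCeilRoot : ∀ m n fuel k → (∀ r → r < k → r ^ m < n) → n ≤ (k + fuel) ^ m →
                    IsCeilRoot m n (search m n fuel k)
search-isCeilRoot m n zero k below n≤ = subst (λ q → n ≤ q ^ m) (+-identityʳ k) n≤ , below
search-isCeilRoot m n (suc fuel) k below n≤ with n ≤ᵇ k ^ m in hit
... | true  = ≤ᵇ⇒≤ n (k ^ m) (subst T (sym hit) tt) , below
... | false = search-isCeilRoot m n fuel (suc k) below′ (subst (λ q → n ≤ q ^ m) (+-suc k fuel) n≤)
  where
  below′ : ∀ r → r < suc k → r ^ m < n
  below′ r r<1+k with m≤n⇒m<n∨m≡n (s≤s⁻¹ r<1+k)
  ... | inj₁ r<k  = below r r<k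
  ... | inj₂ refl = ≰⇒> (λ n≤ → subst T hit (≤⇒≤ᵇ n≤))

ceilRoot-isCeilRoot : ∀ {m} n → 1 ≤ m → IsCeilRoot m n (ceilRoot m n)
ceilRoot-isCeilRoot n 1≤m = search-isCeilRoot _ n n 0 (λ _ ()) (n≤n^m n 1≤m)

isCeilRoot-1 : ∀ {m} → 1 ≤ m → IsCeilRoot m 1 1
isCeilRoot-1 {m} 1≤m = ≤-reflexive (sym (^-zeroˡ m)) , λ { zero _ → 0^m<n 1≤m ≤-refl ; (suc _) (s≤s ()) }

isCeilRoot-2 : ∀ {m n} → 2 ≤ n → n ≤ 2 ^ m → IsCeilRoot m n 2
isCeilRoot-2 {m} 2≤n n≤2^m = n≤2^m , λ r r<2 → <-≤-trans (s≤s (r^m≤1 m (s≤s⁻¹ r<2))) 2≤n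

isCeilRoot⇒1<q : ∀ {m n q} → 2 ≤ n → IsCeilRoot m n q → 1 < q
isCeilRoot⇒1<q {m} 2≤n (n≤q^m , _) =
  ≰⇒> λ q≤1 → <-irrefl refl (<-≤-trans (≤-<-trans n≤q^m (s≤s (r^m≤1 m q≤1))) 2≤n)

-- Avoiding a few forbidden choices

funToFin-cong : ∀ {r} m {f g : Fin m → Fin r} → (∀ i → f i ≡ g i) → funToFin f ≡ funToFin g
funToFin-cong zero    f≗g = refl
funToFin-cong (suc m) f≗g = cong₂ F.combine (f≗g F.zero) (funToFin-cong m (λ i → f≗g (F.suc i)))

finToFun-injective : ∀ {r} m {t u : Fin (r ^ m)} → (∀ i → finToFun t i ≡ finToFun u i) → t ≡ u
finToFun-injective {r} m {t} {u} same = begin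
  t                                ≡⟨ FP.funToFin-finToFin {m} {r} t ⟨
  funToFin (finToFun {r} {m} t)    ≡⟨ funToFin-cong m same ⟩
  funToFin (finToFun {r} {m} u)    ≡⟨ FP.funToFin-finToFin {m} {r} u ⟩
  u                                ∎
  where open ≡-Reasoning

pigeonhole-→ : ∀ {r m n} → r ^ m < n → (f : Fin n → Fin m → Fin r) →
               ∃₂ λ x y → x ≢ y × (∀ i → f x i ≡ f y i)
pigeonhole-→ {r} {m} r^m<n f with FP.pigeonhole r^m<n (λ x → funToFin (f x))
... | x , y , x<y , same = x , y , FP.<⇒≢ x<y , λ i → begin
  f x i                       ≡⟨ FP.finToFun-funToFin (f x) i ⟨
  finToFun (funToFin (f x)) i ≡⟨ cong (λ t → finToFun t i) same ⟩
  finToFun (funToFin (f y)) i ≡⟨ FP.finToFun-funToFin (f y) i ⟩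
  f y i                       ∎
  where open ≡-Reasoning

hits? : ∀ {r N K} (choice : Fin N → Fin r → ℕ) (forbidden : Fin K → Fin N → ℕ) (t : Fin (r ^ N)) →
        Dec (∃ λ s → ∀ i → choice i (finToFun t i) ≡ forbidden s i)
hits? choice forbidden t = FP.any? λ s → FP.all? λ i → choice i (finToFun t i) ≟ forbidden s i

avoid : ∀ {r N K} (choice : Fin N → Fin r → ℕ) → (∀ i → Injective _≡_ _≡_ (choice i)) →
        K < r ^ N → (forbidden : Fin K → Fin N → ℕ) →
        ∃ λ (pick : Fin N → Fin r) → ∀ s → ∃ λ i → choice i (pick i) ≢ forbidden s i
avoid {r} {N} choice injective K<r^N forbidden with FP.all? (hits? choice forbidden)
... | no notAllHit with FP.¬∀⟶∃¬ (r ^ N) _ (hits? choice forbidden) notAllHit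
...   | t , missed = finToFun t , λ s →
  FP.¬∀⟶∃¬ N _ (λ i → choice i (finToFun t i) ≟ forbidden s i) (λ hit → missed (s , hit))
avoid {r} {N} choice injective K<r^N forbidden | yes allHit
  with FP.pigeonhole K<r^N (λ t → proj₁ (allHit t))
... | t , u , t<u , sameHit = ⊥-elim (FP.<⇒≢ t<u (finToFun-injective N λ i → injective i (begin
  choice i (finToFun t i)           ≡⟨ proj₂ (allHit t) i ⟩
  forbidden (proj₁ (allHit t)) i    ≡⟨ cong (λ s → forbidden s i) sameHit ⟩
  forbidden (proj₁ (allHit u)) i    ≡⟨ proj₂ (allHit u) i ⟨
  choice i (finToFun u i)           ∎)))
  where open ≡-Reasoning

avoid-values : ∀ {r K} (choice : Fin r → ℕ) → Injective _≡_ _≡_ choice → K < r → (forbidden : Fin K → ℕ) →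
               ∃ λ t → ∀ s → choice t ≢ forbidden s
avoid-values {r} {K} choice injective K<r forbidden
  with avoid (λ _ → choice) (λ _ → injective) (subst (K <_) (sym (*-identityʳ r)) K<r) (λ s _ → forbidden s)
... | pick , avoids = pick F.zero , λ s → at-zero (avoids s)
  where
  at-zero : ∀ {P : Fin 1 → Set} → ∃ P → P F.zero
  at-zero (F.zero , p) = p

-- Matrices with distinct rows and separated columns

-- Column j has to differ from the later columns whose indices are listed by
-- partner j; indices are naturals so that dropping column 0 is just pred.
record Separating {r N M : ℕ} (choice : Fin N → Fin M → Fin r → ℕ)
                  (degree : Fin M → ℕ) (partner : (j : Fin M) → Fin (degree j) → ℕ) : Set where
  field
    pick : Fin N → Fin M → Fin r

  entry : Fin N → Fin M → ℕ
  entry i j = choice i j (pick i j)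

  field
    rows-differ     : ∀ {i i′} → i ≢ i′ → ∃ λ j → entry i j ≢ entry i′ j
    partners-differ : ∀ {j j′} t → partner j t ≡ toℕ j′ → j F.< j′ → ∃ λ i → entry i j ≢ entry i j′

module _ {r : ℕ} where

  add-row : ∀ {N M} {choice : Fin (suc N) → Fin M → Fin r → ℕ} {degree partner} →
            (∀ j → Injective _≡_ _≡_ (choice F.zero j)) → N < r ^ M →
            Separating (λ i → choice (F.suc i)) (λ _ → M) (λ _ → toℕ) →
            Separating choice degree partner
  add-row {N} {M} {choice} {degree} {partner} injective N<r^M rest = record
    { pick = pick ; rows-differ = rows-differ ; partners-differ = partners-differ }
    where
    module B = Separating rest
    new = avoid (choice F.zero) injective N<r^M B.entry
    pick : Fin (suc N) → Fin M → Fin r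
    pick F.zero    = proj₁ new
    pick (F.suc i) = B.pick i
    entry : Fin (suc N) → Fin M → ℕ
    entry i j = choice i j (pick i j)
    rows-differ : ∀ {i i′} → i ≢ i′ → ∃ λ j → entry i j ≢ entry i′ j
    rows-differ {F.zero}  {F.zero}   0≢0 = ⊥-elim (0≢0 refl)
    rows-differ {F.zero}  {F.suc i′} _   = proj₂ new i′
    rows-differ {F.suc i} {F.zero}   _   with proj₂ new i
    ... | j , differ = j , ≢-sym differ
    rows-differ {F.suc i} {F.suc i′} i≢i′ = B.rows-differ (λ i≡i′ → i≢i′ (cong F.suc i≡i′))
    partners-differ : ∀ {j j′} t → partner j t ≡ toℕ j′ → j F.< j′ → ∃ λ i → entry i j ≢ entry i j′
    partners-differ {j} {j′} _ _ j<j′ with B.partners-differ j′ refl j<j′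
    ... | i , differ = F.suc i , differ

  add-column : ∀ {N M} {choice : Fin N → Fin (suc M) → Fin r → ℕ} {degree partner} →
               (∀ i → Injective _≡_ _≡_ (choice i F.zero)) → degree F.zero < r ^ N →
               Separating (λ i j → choice i (F.suc j)) (λ j → degree (F.suc j)) (λ j t → pred (partner (F.suc j) t)) →
               Separating choice degree partner
  add-column {N} {M} {choice} {degree} {partner} injective degree<r^N right = record
    { pick = pick ; rows-differ = rows-differ ; partners-differ = partners-differ }
    where
    module R = Separating right
    column : ℕ → Fin N → ℕ
    column zero    _ = 0
    column (suc j) i with j <? M
    ... | yes j<M = R.entry i (fromℕ< j<M)
    ... | no _    = 0
    column-toℕ : ∀ j i → column (suc (toℕ j)) i ≡ R.entry i j
    column-toℕ j i with toℕ j <? M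
    ... | yes j<M = cong (R.entry i) (FP.fromℕ<-toℕ j j<M)
    ... | no j≮M  = ⊥-elim (j≮M (FP.toℕ<n j))
    new = avoid (λ i → choice i F.zero) injective degree<r^N (λ t → column (partner F.zero t))
    pick : Fin N → Fin (suc M) → Fin r
    pick i F.zero    = proj₁ new i
    pick i (F.suc j) = R.pick i j
    entry : Fin N → Fin (suc M) → ℕ
    entry i j = choice i j (pick i j)
    rows-differ : ∀ {i i′} → i ≢ i′ → ∃ λ j → entry i j ≢ entry i′ j
    rows-differ i≢i′ with R.rows-differ i≢i′
    ... | j , differ = F.suc j , differ
    partners-differ : ∀ {j j′} t → partner j t ≡ toℕ j′ → j F.< j′ → ∃ λ i → entry i j ≢ entry i j′
    partners-differ {F.zero} {F.suc j′} t is-j′ _ with proj₂ new t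
    ... | i , differ = i , λ same → differ (trans same (sym (trans (cong (λ p → column p i) is-j′) (column-toℕ j′ i))))
    partners-differ {F.suc j} {F.suc j′} t is-j′ (s≤s j<j′) = R.partners-differ t (cong pred is-j′) j<j′

  separating : ∀ {N M} {choice : Fin N → Fin M → Fin r → ℕ} {degree partner} → 1 < r →
               (∀ i j → Injective _≡_ _≡_ (choice i j)) → (∀ j → degree j < r ^ N) → N ≤ r ^ M →
               Separating choice degree partner
  -- A row is added while M < N, on top of a matrix with all columns distinct
  -- (affordable as M < N < r ^ N); otherwise a column is added, and
  -- N ≤ M + 1 ≤ r ^ M keeps the rows affordable.
  separating {N} {M} 1<r injective degree< N≤r^M with M <? N
  separating {zero}  {M}     _ _ _ _ | yes ()
  separating {suc N} {M} 1<r injective degree< N<r^M | yes M<1+N =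
    add-row (injective F.zero) N<r^M
      (separating 1<r (λ i → injective (F.suc i)) (λ _ → ≤-<-trans (s≤s⁻¹ M<1+N) (n<r^n 1<r N))
        (≤-trans (n≤1+n N) N<r^M))
  separating {zero}  {zero}  _ _ _ _ | no _ = record
    { pick = λ () ; rows-differ = λ { {()} } ; partners-differ = λ { {()} } }
  separating {N} {suc M} 1<r injective degree< N≤r^M | no 1+M≮N =
    add-column (λ i → injective i F.zero) (degree< F.zero)
      (separating 1<r (λ i j → injective i (F.suc j)) (λ j → degree< (F.suc j))
        (≤-trans (≮⇒≥ 1+M≮N) (n<r^n 1<r M)))
  separating {suc N} {zero} _ _ _ _ | no 0≮1+N = ⊥-elim (0≮1+N (s≤s z≤n))

-- Short rainbow walks

module Rainbow (G : Graph) where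
  open Graph G

  Joins : (∀ {u v} → Walk G u v → Set) → Colouring G → Set
  Joins Good c = ∀ u v → Σ (Walk G u v) λ p → Good p × Rainbow G c p

  geodesic⇒path : ∀ {u v} {p : Walk G u v} → IsGeodesic G p → IsPath G p
  geodesic⇒path = proj₁

  relax : (Good : ∀ {u v} → Walk G u v → Set) → (∀ {u v} {p : Walk G u v} → IsGeodesic G p → Good p) → ∀ {c u v} →
          (Σ (Walk G u v) λ p → IsGeodesic G p × Rainbow G c p) → Σ (Walk G u v) λ p → Good p × Rainbow G c p
  relax Good geodesic⇒good (p , geodesic , rainbow) = p , geodesic⇒good geodesic , rainbow

  stay : ∀ c u → Σ (Walk G u u) λ p → IsGeodesic G p × Rainbow G c p
  stay c u = [] , ([]ᴬ ∷ᴾ []ᴾ , λ _ _ → z≤n) , []ᴾ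

  step : ∀ c {u v} → u ≢ v → (a : Adj u v) → Σ (Walk G u v) λ p → IsGeodesic G p × Rainbow G c p
  step c {u} {v} u≢v a = a ∷ [] , (((u≢v ∷ᴬ []ᴬ) ∷ᴾ []ᴬ ∷ᴾ []ᴾ) , shortest) , []ᴬ ∷ᴾ []ᴾ
    where
    shortest : (q : Walk G u v) → IsPath G q → 1 ≤ len G q
    shortest []      _ = ⊥-elim (u≢v refl)
    shortest (_ ∷ _) _ = s≤s z≤n

  path² : ∀ {u w v} → u ≢ w → u ≢ v → w ≢ v → (a : Adj u w) (b : Adj w v) → IsPath G (a ∷ (b ∷ []))
  path² u≢w u≢v w≢v _ _ = (u≢w ∷ᴬ u≢v ∷ᴬ []ᴬ) ∷ᴾ (w≢v ∷ᴬ []ᴬ) ∷ᴾ []ᴬ ∷ᴾ []ᴾ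

  step² : ∀ c {u w v} → u ≢ w → u ≢ v → w ≢ v → ¬ Adj u v → (a : Adj u w) (b : Adj w v) →
          c (edge a) ≢ c (edge b) → Σ (Walk G u v) λ p → IsGeodesic G p × Rainbow G c p
  step² c {u} {w} {v} u≢w u≢v w≢v ¬uv a b differ =
    a ∷ (b ∷ []) , (path² u≢w u≢v w≢v a b , shortest) , ((differ ∷ᴬ []ᴬ) ∷ᴾ []ᴬ ∷ᴾ []ᴾ)
    where
    shortest : (q : Walk G u v) → IsPath G q → 2 ≤ len G q
    shortest []            _ = ⊥-elim (u≢v refl)
    shortest (a′ ∷ [])     _ = ⊥-elim (¬uv a′)
    shortest (_ ∷ (_ ∷ _)) _ = s≤s (s≤s z≤n)

  step³ : ∀ c {u w w′ v} → u ≢ w → u ≢ w′ → u ≢ v → w ≢ w′ → w ≢ v → w′ ≢ v →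
          (a : Adj u w) (b : Adj w w′) (d : Adj w′ v) →
          c (edge a) ≢ c (edge b) → c (edge a) ≢ c (edge d) → c (edge b) ≢ c (edge d) →
          Σ (Walk G u v) λ p → IsPath G p × Rainbow G c p
  step³ c u≢w u≢w′ u≢v w≢w′ w≢v w′≢v a b d ab ad bd =
    a ∷ (b ∷ (d ∷ [])) ,
    ((u≢w ∷ᴬ u≢w′ ∷ᴬ u≢v ∷ᴬ []ᴬ) ∷ᴾ (w≢w′ ∷ᴬ w≢v ∷ᴬ []ᴬ) ∷ᴾ (w′≢v ∷ᴬ []ᴬ) ∷ᴾ []ᴬ ∷ᴾ []ᴾ) ,
    ((ab ∷ᴬ ad ∷ᴬ []ᴬ) ∷ᴾ (bd ∷ᴬ []ᴬ) ∷ᴾ []ᴬ ∷ᴾ []ᴾ)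

  rainbow-two-colours⇒len≤2 : ∀ c → (∀ e → c e < 2) → ∀ {u v} (p : Walk G u v) → Rainbow G c p → len G p ≤ 2
  rainbow-two-colours⇒len≤2 c _ []             _ = z≤n
  rainbow-two-colours⇒len≤2 c _ (_ ∷ [])       _ = s≤s z≤n
  rainbow-two-colours⇒len≤2 c _ (_ ∷ (_ ∷ [])) _ = s≤s (s≤s z≤n)
  rainbow-two-colours⇒len≤2 c bit (a ∷ (b ∷ (d ∷ _))) ((ab ∷ᴬ ad ∷ᴬ _) ∷ᴾ (bd ∷ᴬ _) ∷ᴾ _) =
    ⊥-elim (no-three-distinct-bits (bit (edge a)) (bit (edge b)) (bit (edge d)) ab ad bd)
    where
    no-three-distinct-bits : ∀ {x y z} → x < 2 → y < 2 → z < 2 → x ≢ y → x ≢ z → y ≢ z → ⊥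
    no-three-distinct-bits (s≤s z≤n)       (s≤s z≤n)       _               xy _  _  = xy refl
    no-three-distinct-bits (s≤s (s≤s z≤n)) (s≤s (s≤s z≤n)) _               xy _  _  = xy refl
    no-three-distinct-bits (s≤s z≤n)       _               (s≤s z≤n)       _  xz _  = xz refl
    no-three-distinct-bits (s≤s (s≤s z≤n)) _               (s≤s (s≤s z≤n)) _  xz _  = xz refl
    no-three-distinct-bits _               (s≤s z≤n)       (s≤s z≤n)       _  _  yz = yz refl
    no-three-distinct-bits _               (s≤s (s≤s z≤n)) (s≤s (s≤s z≤n)) _  _  yz = yz refl

  first-choice : ∀ {r} L → 1 ≤ r → IsListAssignment G r L → Σ (Colouring G) (IsLColouring G L)
  first-choice L 1≤r isList =
    (λ e → proj₁ (isList e) (fromℕ< 1≤r)) , (λ e → proj₂ (proj₂ (isList e)) (fromℕ< 1≤r))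

  listSRC⇒listRC : ∀ r → ListSRC G r → ListRC G r
  listSRC⇒listRC r src L isList with src L isList
  ... | c , isL , joins = c , isL , λ u v → relax (IsPath G) geodesic⇒path (joins u v)

-- Bookkeeping on finite types

flatten : ∀ {k} (s : Fin k → ℕ) → Σ (Fin k) (Fin ∘ s) → Fin (sumFin k s)
flatten {suc k} s (F.zero  , b) = b ↑ˡ sumFin k (s ∘ F.suc)
flatten {suc k} s (F.suc i , b) = s F.zero ↑ʳ flatten (s ∘ F.suc) (i , b)

unflatten : ∀ {k} (s : Fin k → ℕ) → Fin (sumFin k s) → Σ (Fin k) (Fin ∘ s)
unflatten {suc k} s j with splitAt (s F.zero) j
... | inj₁ b  = F.zero , b
... | inj₂ j′ with unflatten (s ∘ F.suc) j′
...   | i , b = F.suc i , b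

unflatten-flatten : ∀ {k} (s : Fin k → ℕ) w → unflatten s (flatten s w) ≡ w
unflatten-flatten {suc k} s (F.zero , b) rewrite FP.splitAt-↑ˡ (s F.zero) b (sumFin k (s ∘ F.suc)) = refl
unflatten-flatten {suc k} s (F.suc i , b)
  rewrite FP.splitAt-↑ʳ (s F.zero) (sumFin k (s ∘ F.suc)) (flatten (s ∘ F.suc) (i , b))
        | unflatten-flatten (s ∘ F.suc) (i , b) = refl

flatten-unflatten : ∀ {k} (s : Fin k → ℕ) j → flatten s (unflatten s j) ≡ j
flatten-unflatten {suc k} s j with splitAt (s F.zero) j in split
... | inj₁ b  = FP.splitAt⁻¹-↑ˡ split
... | inj₂ j′ with unflatten (s ∘ F.suc) j′ | flatten-unflatten (s ∘ F.suc) j′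
...   | i , b | flatten-rest = trans (cong (s F.zero ↑ʳ_) flatten-rest) (FP.splitAt⁻¹-↑ʳ split)

flatten-injectiveʳ : ∀ {k} (s : Fin k → ℕ) {i a b} → flatten s (i , a) ≡ flatten s (i , b) → a ≡ b
flatten-injectiveʳ s {i} {a} {b} same
  with trans (sym (unflatten-flatten s (i , a))) (trans (cong (unflatten s) same) (unflatten-flatten s (i , b)))
... | refl = refl

unflatten-sameClass : ∀ {k} (s : Fin k → ℕ) j j′ → proj₁ (unflatten s j) ≡ proj₁ (unflatten s j′) →
                      ∃ λ t → flatten s (proj₁ (unflatten s j) , t) ≡ j′
unflatten-sameClass s j j′ same with unflatten s j | unflatten s j′ | flatten-unflatten s j′
unflatten-sameClass s j _ refl | i , _ | .i , b | refl = b , refl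

term≤sumFin : ∀ {k} (f : Fin k → ℕ) i → f i ≤ sumFin k f
term≤sumFin f F.zero    = m≤m+n (f F.zero) _
term≤sumFin f (F.suc i) = ≤-trans (term≤sumFin (f ∘ F.suc) i) (m≤n+m _ (f F.zero))

k≤sumFin : ∀ {k} (f : Fin k → ℕ) → (∀ i → 1 ≤ f i) → k ≤ sumFin k f
k≤sumFin {zero}  f _        = z≤n
k≤sumFin {suc k} f positive = +-mono-≤ (positive F.zero) (k≤sumFin (f ∘ F.suc) (positive ∘ F.suc))

Fin≤1-unique : ∀ {N} → N ≤ 1 → (a b : Fin N) → a ≡ b
Fin≤1-unique _                      F.zero F.zero = refl
Fin≤1-unique {suc (suc _)} (s≤s ()) _      _

data TopView {k : ℕ} : Fin (suc k) → Set where
  low : (i : Fin k) → TopView (inject₁ i)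
  top : TopView (fromℕ k)

topView : ∀ {k} (c : Fin (suc k)) → TopView c
topView {zero}  F.zero    = top
topView {suc k} F.zero    = low F.zero
topView {suc k} (F.suc c) with topView c
... | low i = low (F.suc i)
... | top   = top

topView-fromℕ : ∀ k → topView (fromℕ k) ≡ top
topView-fromℕ zero = refl
topView-fromℕ (suc k) rewrite topView-fromℕ k = refl

topView-inject₁ : ∀ {k} (i : Fin k) → topView (inject₁ i) ≡ low i
topView-inject₁ {suc k} F.zero    = refl
topView-inject₁ {suc k} (F.suc i) rewrite topView-inject₁ i = refl

-- The complete multipartite graph

module Multipartite (k : ℕ) (ns : Fin (suc k) → ℕ) where

  G : Graph
  G = CompleteMultipartite (suc k) ns

  open Graph G public using (V; Adj; Edge; edge)
  open Rainbow G public

  n : ℕ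
  n = ns (fromℕ k)

  s : Fin k → ℕ
  s i = ns (inject₁ i)

  m : ℕ
  m = sumFin k s

  W : Set
  W = Σ (Fin k) (Fin ∘ s)

  X : Fin n → V
  X x = fromℕ k , x

  Y : W → V
  Y (i , b) = inject₁ i , b

  inject₁<fromℕ : (i : Fin k) → inject₁ i F.< fromℕ k
  inject₁<fromℕ i = subst₂ _<_ (sym (FP.toℕ-inject₁ i)) (sym (FP.toℕ-fromℕ k)) (FP.toℕ<n i)

  xw : Fin n → W → Edge
  xw x (i , b) = inject₁ i , fromℕ k , inject₁<fromℕ i , b , x

  xw-irrelevant : ∀ x i b (i<top : inject₁ i F.< fromℕ k) → (inject₁ i , fromℕ k , i<top , b , x) ≡ xw x (i , b)
  xw-irrelevant x i b i<top = cong (λ p → inject₁ i , fromℕ k , p , b , x) (FP.<-irrelevant i<top (inject₁<fromℕ i))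

  edge-XY : ∀ {x} w (a : Adj (X x) (Y w)) → edge a ≡ xw x w
  edge-XY {x} (i , b) a with FP.<-cmp (fromℕ k) (inject₁ i)
  ... | tri< top<i _ _ = ⊥-elim (FP.<-asym top<i (inject₁<fromℕ i))
  ... | tri≈ _ top≡i _ = ⊥-elim (a top≡i)
  ... | tri> _ _ i<top = xw-irrelevant x i b i<top

  edge-YX : ∀ {x} w (a : Adj (Y w) (X x)) → edge a ≡ xw x w
  edge-YX {x} (i , b) a with FP.<-cmp (inject₁ i) (fromℕ k)
  ... | tri< i<top _ _ = xw-irrelevant x i b i<top
  ... | tri≈ _ i≡top _ = ⊥-elim (a i≡top)
  ... | tri> _ _ top<i = ⊥-elim (FP.<-asym top<i (inject₁<fromℕ i))

  adjacent⇒≢ : ∀ {u v} → Adj u v → u ≢ v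
  adjacent⇒≢ u≁v refl = u≁v refl

  Y~X : ∀ w x → Adj (Y w) (X x)
  Y~X (i , _) _ i≡top = FP.fromℕ≢inject₁ (sym i≡top)

  X~Y : ∀ x w → Adj (X x) (Y w)
  X~Y x w = Y~X w x ∘ sym

  X-Y-X : ∀ x y w → Walk G (X x) (X y)
  X-Y-X x y w = _∷_ {w = Y w} (X~Y x w) (Y~X w y ∷ [])

  X-Y-X-isPath : ∀ {x y} w → x ≢ y → IsPath G (X-Y-X x y w)
  X-Y-X-isPath {x} {y} w x≢y =
    path² {X x} {Y w} {X y} (adjacent⇒≢ (X~Y x w)) (λ { refl → x≢y refl }) (adjacent⇒≢ (Y~X w y)) (X~Y x w) (Y~X w y)

  through-Y : ∀ c {x y} w → x ≢ y → c (xw x w) ≢ c (xw y w) →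
              Σ (Walk G (X x) (X y)) λ p → IsGeodesic G p × Rainbow G c p
  through-Y c {x} {y} w x≢y differ =
    step² c (adjacent⇒≢ (X~Y x w)) (λ { refl → x≢y refl }) (adjacent⇒≢ (Y~X w y)) (λ top≢top → top≢top refl)
      (X~Y x w) (Y~X w y)
      (subst₂ (λ e e′ → c e ≢ c e′) (sym (edge-XY w (X~Y x w))) (sym (edge-YX w (Y~X w y))) differ)

  through-X : ∀ c {i a b} x → a ≢ b → c (xw x (i , a)) ≢ c (xw x (i , b)) →
              Σ (Walk G (Y (i , a)) (Y (i , b))) λ p → IsGeodesic G p × Rainbow G c p
  through-X c {i} {a} {b} x a≢b differ =
    step² c (adjacent⇒≢ (Y~X (i , a) x)) (λ { refl → a≢b refl }) (adjacent⇒≢ (X~Y x (i , b))) (λ i≢i → i≢i refl)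
      (Y~X (i , a) x) (X~Y x (i , b))
      (subst₂ (λ e e′ → c e ≢ c e′) (sym (edge-YX (i , a) (Y~X (i , a) x))) (sym (edge-XY (i , b) (X~Y x (i , b)))) differ)

  around : ∀ c {x y α β} (α~β : Adj (Y α) (Y β)) → x ≢ y →
           c (xw x α) ≢ c (edge α~β) → c (xw x α) ≢ c (xw y β) → c (edge α~β) ≢ c (xw y β) →
           Σ (Walk G (X x) (X y)) λ p → IsPath G p × Rainbow G c p
  around c {x} {y} {α} {β} α~β x≢y xα≢αβ xα≢βy αβ≢βy =
    step³ c (adjacent⇒≢ (X~Y x α)) (adjacent⇒≢ (X~Y x β)) (λ { refl → x≢y refl })
      (adjacent⇒≢ α~β) (adjacent⇒≢ (Y~X α y)) (adjacent⇒≢ (Y~X β y)) (X~Y x α) α~β (Y~X β y)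
      (subst (λ e → c e ≢ c (edge α~β)) (sym (edge-XY α (X~Y x α))) xα≢αβ)
      (subst₂ (λ e e′ → c e ≢ c e′) (sym (edge-XY α (X~Y x α))) (sym (edge-YX β (Y~X β y))) xα≢βy)
      (subst (λ e → c (edge α~β) ≢ c e) (sym (edge-YX β (Y~X β y))) αβ≢βy)

  joins : (Good : ∀ {u v} → Walk G u v → Set) → (∀ {u v} {p : Walk G u v} → IsGeodesic G p → Good p) → ∀ c →
          (∀ {x y} → x ≢ y → Σ (Walk G (X x) (X y)) λ p → Good p × Rainbow G c p) →
          (∀ {i a b} → a ≢ b → ∃ λ x → c (xw x (i , a)) ≢ c (xw x (i , b))) →
          Joins Good c
  joins Good geodesic⇒good c X-pairs Y-pairs (ci , a) (cj , b) with ci F.≟ cj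
  ... | no ci≢cj = relax Good geodesic⇒good (step c (adjacent⇒≢ ci≢cj) ci≢cj)
  ... | yes refl with a F.≟ b
  ...   | yes refl = relax Good geodesic⇒good (stay c _)
  ...   | no a≢b with topView ci
  ...     | top   = X-pairs a≢b
  ...     | low i with Y-pairs a≢b
  ...       | x , differ = relax Good geodesic⇒good (through-X c x a≢b differ)

  extend : (Fin n → W → ℕ) → Colouring G → Colouring G
  extend σ d (ci , cj , ci<cj , b , a) with topView cj | topView ci
  ... | low j | _     = d (ci , inject₁ j , ci<cj , b , a)
  ... | top   | low i = σ a (i , b)
  ... | top   | top   = ⊥-elim (FP.<-irrefl refl ci<cj)

  extend-xw : ∀ σ d x w → extend σ d (xw x w) ≡ σ x w
  extend-xw σ d x (i , b) rewrite topView-fromℕ k | topView-inject₁ i = refl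

  extend-≢ : ∀ σ d {x y w w′} → σ x w ≢ σ y w′ → extend σ d (xw x w) ≢ extend σ d (xw y w′)
  extend-≢ σ d {x} {y} {w} {w′} = subst₂ _≢_ (sym (extend-xw σ d x w)) (sym (extend-xw σ d y w′))

  extend-YY : ∀ σ d {w w′} (a : Adj (Y w) (Y w′)) → extend σ d (edge {Y w} {Y w′} a) ≡ d (edge a)
  extend-YY σ d {i , _} {j , _} a with FP.<-cmp (inject₁ i) (inject₁ j)
  ... | tri< _ _ _     rewrite topView-inject₁ j = refl
  ... | tri≈ _ i≡j _   = ⊥-elim (a i≡j)
  ... | tri> _ _ _     rewrite topView-inject₁ i = refl

  extend-isL : ∀ L σ d → (∀ x w → L (xw x w) (σ x w)) → IsLColouring G L d → IsLColouring G L (extend σ d)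
  extend-isL L σ d σ-isL d-isL (ci , cj , ci<cj , b , a) with topView cj | topView ci
  ... | low j | _     = d-isL _
  ... | top   | low i = subst (λ e → L e (σ a (i , b))) (sym (xw-irrelevant a i b ci<cj)) (σ-isL a (i , b))
  ... | top   | top   = ⊥-elim (FP.<-irrefl refl ci<cj)

  SameRow : Colouring G → Fin n → Fin n → Set
  SameRow c x y = ∀ w → c (xw x w) ≡ c (xw y w)

  short-walks-not-rainbow : ∀ c {x y} → SameRow c x y → x ≢ y →
                            (p : Walk G (X x) (X y)) → len G p ≤ 2 → ¬ Rainbow G c p
  short-walks-not-rainbow c same x≢y []             _ _ = x≢y refl
  short-walks-not-rainbow c same x≢y (top≢top ∷ []) _ _ = top≢top refl
  short-walks-not-rainbow c {x} {y} same x≢y (_∷_ {w = cw , b} p (q ∷ [])) _ ((differ ∷ᴬ []ᴬ) ∷ᴾ _)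
    with topView cw
  ... | top   = p refl
  ... | low i = differ (begin
    c (edge p)       ≡⟨ cong c (edge-XY (i , b) p) ⟩
    c (xw x (i , b)) ≡⟨ same (i , b) ⟩
    c (xw y (i , b)) ≡⟨ cong c (edge-YX (i , b) q) ⟨
    c (edge q)       ∎)
    where open ≡-Reasoning
  short-walks-not-rainbow c same x≢y (_ ∷ (_ ∷ (_ ∷ _))) (s≤s (s≤s ())) _

  rows-repeat : ∀ {r} c → (∀ e → c e < r) → r ^ m < n → ∃₂ λ x y → x ≢ y × SameRow c x y
  rows-repeat c c<r r^m<n with pigeonhole-→ r^m<n (λ x j → fromℕ< (c<r (xw x (unflatten s j))))
  ... | x , y , x≢y , same = x , y , x≢y , λ w →
    subst (λ w → c (xw x w) ≡ c (xw y w)) (unflatten-flatten s w) (same-at (flatten s w))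
    where
    same-at : ∀ j → c (xw x (unflatten s j)) ≡ c (xw y (unflatten s j))
    same-at j = begin
      c (xw x (unflatten s j))                   ≡⟨ FP.toℕ-fromℕ< _ ⟨
      toℕ (fromℕ< (c<r (xw x (unflatten s j)))) ≡⟨ cong toℕ (same j) ⟩
      toℕ (fromℕ< (c<r (xw y (unflatten s j)))) ≡⟨ FP.toℕ-fromℕ< _ ⟩
      c (xw y (unflatten s j))                   ∎
      where open ≡-Reasoning

  colours-below : ℕ → EdgeLists G
  colours-below r _ colour = colour < r

  colours-below-isList : ∀ r → IsListAssignment G r (colours-below r)
  colours-below-isList r _ = toℕ , FP.toℕ-injective , FP.toℕ<n

  ¬listSRC : ∀ r → W → r ^ m < n → ¬ ListSRC G r
  ¬listSRC r w r^m<n src with src (colours-below r) (colours-below-isList r)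
  ... | c , c<r , joined with rows-repeat c c<r r^m<n
  ...   | x , y , x≢y , same with joined (X x) (X y)
  ...     | p , (_ , shortest) , rainbow =
    short-walks-not-rainbow c same x≢y p (shortest (X-Y-X x y w) (X-Y-X-isPath w x≢y)) rainbow

  ¬listRC : ∀ r → r ≤ 2 → r ^ m < n → ¬ ListRC G r
  ¬listRC r r≤2 r^m<n rc with rc (colours-below r) (colours-below-isList r)
  ... | c , c<r , joined with rows-repeat c c<r r^m<n
  ...   | x , y , x≢y , same with joined (X x) (X y)
  ...     | p , _ , rainbow =
    short-walks-not-rainbow c same x≢y p (rainbow-two-colours⇒len≤2 c (λ e → <-≤-trans (c<r e) r≤2) p rainbow) rainbow

  record ClassSeparating {r N : ℕ} (choice : Fin N → W → Fin r → ℕ) : Set where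
    field
      pick : Fin N → W → Fin r

    entry : Fin N → W → ℕ
    entry x w = choice x w (pick x w)

    field
      rows-differ       : ∀ {x y} → x ≢ y → ∃ λ w → entry x w ≢ entry y w
      classmates-differ : ∀ {i a b} → a ≢ b → ∃ λ x → entry x (i , a) ≢ entry x (i , b)

  classSeparating : ∀ {r N} {choice : Fin N → W → Fin r → ℕ} → 1 < r → (∀ x w → Injective _≡_ _≡_ (choice x w)) →
                    N ≤ r ^ m → (∀ i → s i < r ^ N) → ClassSeparating choice
  classSeparating {r} {N} {choice} 1<r injective N≤r^m s<r^N = record
    { pick = λ x w → S.pick x (flatten s w) ; rows-differ = rows-differ ; classmates-differ = classmates-differ }
    where
    class : Fin m → Fin k
    class j = proj₁ (unflatten s j)
    S : Separating (λ x j → choice x (unflatten s j)) (s ∘ class) (λ j t → toℕ (flatten s (class j , t)))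
    S = separating 1<r (λ x j → injective x (unflatten s j)) (λ j → s<r^N (class j)) N≤r^m
    module S = Separating S
    entry : Fin N → W → ℕ
    entry x w = choice x w (S.pick x (flatten s w))
    entry-flatten : ∀ x w → S.entry x (flatten s w) ≡ entry x w
    entry-flatten x w = cong (λ w′ → choice x w′ (S.pick x (flatten s w))) (unflatten-flatten s w)
    entry-unflatten : ∀ x j → S.entry x j ≡ entry x (unflatten s j)
    entry-unflatten x j = trans (cong (S.entry x) (sym (flatten-unflatten s j))) (entry-flatten x (unflatten s j))
    rows-differ : ∀ {x y} → x ≢ y → ∃ λ w → entry x w ≢ entry y w
    rows-differ x≢y with S.rows-differ x≢y
    ... | j , differ = unflatten s j , subst₂ _≢_ (entry-unflatten _ j) (entry-unflatten _ j) differ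
    class-flatten : ∀ w → class (flatten s w) ≡ proj₁ w
    class-flatten w = cong proj₁ (unflatten-flatten s w)
    ordered : ∀ {i a b} → flatten s (i , a) F.< flatten s (i , b) → ∃ λ x → entry x (i , a) ≢ entry x (i , b)
    ordered {i} {a} {b} a<b
      with unflatten-sameClass s _ _ (trans (class-flatten (i , a)) (sym (class-flatten (i , b))))
    ... | t , is-b with S.partners-differ t (cong toℕ is-b) a<b
    ...   | x , differ = x , subst₂ _≢_ (entry-flatten x (i , a)) (entry-flatten x (i , b)) differ
    classmates-differ : ∀ {i a b} → a ≢ b → ∃ λ x → entry x (i , a) ≢ entry x (i , b)
    classmates-differ {i} {a} {b} a≢b with FP.<-cmp (flatten s (i , a)) (flatten s (i , b))
    ... | tri< a<b _ _ = ordered a<b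
    ... | tri≈ _ a≡b _ = ⊥-elim (a≢b (flatten-injectiveʳ s a≡b))
    ... | tri> _ _ b<a with ordered b<a
    ...   | x , differ = x , ≢-sym differ

  listSRC-singletons : (∀ c → ns c ≤ 1) → ∀ r → 1 ≤ r → ListSRC G r
  listSRC-singletons ns≤1 r 1≤r L isList with first-choice L 1≤r isList
  ... | c , c-isL = c , c-isL , joins (IsGeodesic G) (λ geodesic → geodesic) c
    (λ x≢y → ⊥-elim (x≢y (Fin≤1-unique (ns≤1 _) _ _)))
    (λ a≢b → ⊥-elim (a≢b (Fin≤1-unique (ns≤1 _) _ _)))

  listSRC : ∀ r → 1 < r → (∀ i → s i ≤ n) → n ≤ r ^ m → ListSRC G r
  listSRC r 1<r s≤n n≤r^m L isList =
    c , extend-isL L entry d (λ x w → proj₂ (proj₂ (isList (xw x w))) (pick x w)) d-isL ,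
    joins (IsGeodesic G) (λ geodesic → geodesic) c X-pairs Y-pairs
    where
    open ClassSeparating (classSeparating {choice = λ x w → proj₁ (isList (xw x w))} 1<r
      (λ x w → proj₁ (proj₂ (isList (xw x w)))) n≤r^m (λ i → ≤-<-trans (s≤n i) (n<r^n 1<r n)))
    d = proj₁ (first-choice L (<⇒≤ 1<r) isList)
    d-isL = proj₂ (first-choice L (<⇒≤ 1<r) isList)
    c : Colouring G
    c = extend entry d
    X-pairs : ∀ {x y} → x ≢ y → Σ (Walk G (X x) (X y)) λ p → IsGeodesic G p × Rainbow G c p
    X-pairs x≢y with rows-differ x≢y
    ... | w , differ = through-Y c w x≢y (extend-≢ entry d differ)
    Y-pairs : ∀ {i a b} → a ≢ b → ∃ λ x → c (xw x (i , a)) ≢ c (xw x (i , b))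
    Y-pairs a≢b with classmates-differ a≢b
    ... | x , differ = x , extend-≢ entry d differ

  listSRC-root : ∀ {q} → (∀ i → s i ≤ n) → 2 ≤ n → IsCeilRoot m n q → ListSRC G q
  listSRC-root s≤n 2≤n root = listSRC _ (isCeilRoot⇒1<q {m} 2≤n root) s≤n (proj₁ root)

  srcℓ≡-root : ∀ {q} → W → IsCeilRoot m n q → ListSRC G q → srcℓ≡ G q
  srcℓ≡-root w (_ , below) upper = upper , λ r r<q → ¬listSRC r w (below r r<q)

  rcℓ≡-root : ∀ {q} → IsCeilRoot m n q → ListRC G (q ⊓ 3) → rcℓ≡ G (q ⊓ 3)
  rcℓ≡-root {q} (_ , below) upper = upper , λ r r<q⊓3 →
    ¬listRC r (s≤s⁻¹ (<-≤-trans r<q⊓3 (m⊓n≤n q 3))) (below r (<-≤-trans r<q⊓3 (m⊓n≤m q 3)))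

module ThreeColours (k : ℕ) (ns : Fin (3 + k) → ℕ) where
  open Multipartite (2 + k) ns

  -- The first m vertices of X get rows of a class-separating matrix; any
  -- other vertex x gets a colour σ x α ≠ γ towards α and σ x β ∉ {γ, σ x α}
  -- towards β, so that x α β y is rainbow whenever the rows of x and y agree
  -- at α and at β.
  module Construction (a₀ : Fin (s F.zero)) (b₀ : Fin (s (F.suc F.zero))) (m≤n : m ≤ n)
                      (L : EdgeLists G) (isList : IsListAssignment G 3 L) where

    colour : Fin n → W → Fin 3 → ℕ
    colour x w = proj₁ (isList (xw x w))

    colour-injective : ∀ x w → Injective _≡_ _≡_ (colour x w)
    colour-injective x w = proj₁ (proj₂ (isList (xw x w)))

    colour-isL : ∀ x w t → L (xw x w) (colour x w t)
    colour-isL x w = proj₂ (proj₂ (isList (xw x w)))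

    d : Colouring G
    d = proj₁ (first-choice L (s≤s z≤n) isList)

    α β : W
    α = F.zero , a₀
    β = F.suc F.zero , b₀

    α~β : Adj (Y α) (Y β)
    α~β ()

    γ : ℕ
    γ = d (edge {Y α} {Y β} α~β)

    inner : Fin m → Fin n
    inner t = inject≤ t m≤n

    inner-fromℕ< : ∀ {x} (x<m : toℕ x < m) → inner (fromℕ< x<m) ≡ x
    inner-fromℕ< x<m = FP.toℕ-injective (trans (FP.toℕ-inject≤ _ m≤n) (FP.toℕ-fromℕ< x<m))

    fromℕ<-≢ : ∀ {x y} (x<m : toℕ x < m) (y<m : toℕ y < m) → x ≢ y → fromℕ< x<m ≢ fromℕ< y<m
    fromℕ<-≢ x<m y<m x≢y e = x≢y (trans (sym (inner-fromℕ< x<m)) (trans (cong inner e) (inner-fromℕ< y<m)))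

    fromℕ<-inner : ∀ t (t<m : toℕ (inner t) < m) → fromℕ< t<m ≡ t
    fromℕ<-inner t t<m = FP.toℕ-injective (trans (FP.toℕ-fromℕ< t<m) (FP.toℕ-inject≤ t m≤n))

    open ClassSeparating (classSeparating {choice = λ t → colour (inner t)} (s≤s (s≤s z≤n))
      (λ t → colour-injective (inner t)) (<⇒≤ (n<r^n (s≤s (s≤s z≤n)) m))
      (λ i → ≤-<-trans (term≤sumFin s i) (n<r^n (s≤s (s≤s z≤n)) m)))

    first-class : ∀ x a → ∃ λ t → Fin 1 → colour x (F.zero , a) t ≢ γ
    first-class x a = avoid-values (colour x (F.zero , a)) (colour-injective x _) (s≤s (s≤s z≤n)) (λ _ → γ)

    γ-or-α : Fin n → Fin 2 → ℕ
    γ-or-α x F.zero    = γ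
    γ-or-α x (F.suc _) = colour x α (proj₁ (first-class x a₀))

    later-class : ∀ x i b → ∃ λ t → ∀ j → colour x (F.suc i , b) t ≢ γ-or-α x j
    later-class x i b = avoid-values (colour x (F.suc i , b)) (colour-injective x _) ≤-refl (γ-or-α x)

    outer-pick : Fin n → W → Fin 3
    outer-pick x (F.zero , a)  = proj₁ (first-class x a)
    outer-pick x (F.suc i , b) = proj₁ (later-class x i b)

    σ : Fin n → W → ℕ
    σ x w with toℕ x <? m
    ... | yes x<m = entry (fromℕ< x<m) w
    ... | no _    = colour x w (outer-pick x w)

    σ-isL : ∀ x w → L (xw x w) (σ x w)
    σ-isL x w with toℕ x <? m
    ... | yes x<m = subst (λ x → L (xw x w) (entry (fromℕ< x<m) w)) (inner-fromℕ< x<m) (colour-isL _ w _)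
    ... | no _    = colour-isL x w _

    σ-inner : ∀ {x} (x<m : toℕ x < m) w → σ x w ≡ entry (fromℕ< x<m) w
    σ-inner {x} x<m w with toℕ x <? m
    ... | yes x<m′ = cong (λ p → entry (fromℕ< p) w) (<-irrelevant x<m′ x<m)
    ... | no x≮m   = ⊥-elim (x≮m x<m)

    σ-outer : ∀ {x} → ¬ toℕ x < m → ∀ w → σ x w ≡ colour x w (outer-pick x w)
    σ-outer {x} x≮m w with toℕ x <? m
    ... | yes x<m = ⊥-elim (x≮m x<m)
    ... | no _    = refl

    σ-outer-avoids : ∀ {x} → ¬ toℕ x < m → σ x α ≢ γ × σ x β ≢ γ × σ x β ≢ σ x α
    σ-outer-avoids {x} x≮m =
      (λ e → proj₂ (first-class x a₀) F.zero (trans (sym (σ-outer x≮m α)) e)) ,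
      (λ e → proj₂ (later-class x F.zero b₀) F.zero (trans (sym (σ-outer x≮m β)) e)) ,
      (λ e → proj₂ (later-class x F.zero b₀) (F.suc F.zero) (trans (sym (σ-outer x≮m β)) (trans e (σ-outer x≮m α))))

    αβ-rainbow : ∀ {x y} → ¬ toℕ x < m ⊎ ¬ toℕ y < m → σ x α ≡ σ y α → σ x β ≡ σ y β →
                 σ x α ≢ γ × σ x α ≢ σ y β × γ ≢ σ y β
    αβ-rainbow (inj₁ x≮m) _ sameβ =
      let xα≢γ , xβ≢γ , xβ≢xα = σ-outer-avoids x≮m
      in xα≢γ , (λ e → xβ≢xα (sym (trans e (sym sameβ)))) , (λ e → xβ≢γ (sym (trans e (sym sameβ))))
    αβ-rainbow (inj₂ y≮m) sameα _ =
      let yα≢γ , yβ≢γ , yβ≢yα = σ-outer-avoids y≮m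
      in (λ e → yα≢γ (trans (sym sameα) e)) , (λ e → yβ≢yα (sym (trans (sym sameα) e))) , ≢-sym yβ≢γ

    c : Colouring G
    c = extend σ d

    c-isL : IsLColouring G L c
    c-isL = extend-isL L σ d σ-isL (proj₂ (first-choice L (s≤s z≤n) isList))

    c-αβ : c (edge {Y α} {Y β} α~β) ≡ γ
    c-αβ = extend-YY σ d {α} {β} α~β

    via-α-or-β : ∀ {x y} → x ≢ y → ¬ toℕ x < m ⊎ ¬ toℕ y < m → Dec (σ x α ≡ σ y α) → Dec (σ x β ≡ σ y β) →
                 Σ (Walk G (X x) (X y)) λ p → IsPath G p × Rainbow G c p
    via-α-or-β x≢y _ (no differ) _ = relax (IsPath G) geodesic⇒path (through-Y c α x≢y (extend-≢ σ d differ))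
    via-α-or-β x≢y _ (yes _) (no differ) = relax (IsPath G) geodesic⇒path (through-Y c β x≢y (extend-≢ σ d differ))
    via-α-or-β {x} {y} x≢y outer (yes sameα) (yes sameβ) =
      let xα≢γ , xα≢yβ , γ≢yβ = αβ-rainbow outer sameα sameβ
      in around c {x} {y} {α} {β} α~β x≢y
           (subst₂ _≢_ (sym (extend-xw σ d x α)) (sym c-αβ) xα≢γ)
           (extend-≢ σ d xα≢yβ)
           (subst₂ _≢_ (sym c-αβ) (sym (extend-xw σ d y β)) γ≢yβ)

    X-pairs : ∀ {x y} → x ≢ y → Σ (Walk G (X x) (X y)) λ p → IsPath G p × Rainbow G c p
    X-pairs {x} {y} x≢y with toℕ x <? m | toℕ y <? m
    ... | no x≮m  | _       = via-α-or-β x≢y (inj₁ x≮m) (σ x α ≟ σ y α) (σ x β ≟ σ y β)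
    ... | yes _   | no y≮m  = via-α-or-β x≢y (inj₂ y≮m) (σ x α ≟ σ y α) (σ x β ≟ σ y β)
    ... | yes x<m | yes y<m
      with rows-differ (fromℕ<-≢ x<m y<m x≢y)
    ...   | w , differ = relax (IsPath G) geodesic⇒path
      (through-Y c w x≢y (extend-≢ σ d (subst₂ _≢_ (sym (σ-inner x<m w)) (sym (σ-inner y<m w)) differ)))

    Y-pairs : ∀ {i a b} → a ≢ b → ∃ λ x → c (xw x (i , a)) ≢ c (xw x (i , b))
    Y-pairs {i} {a} {b} a≢b with classmates-differ a≢b
    ... | t , differ = inner t , extend-≢ σ d (subst₂ _≢_ (sym (σ-inner-at (i , a))) (sym (σ-inner-at (i , b))) differ)
      where
      t<m : toℕ (inner t) < m
      t<m = subst (_< m) (sym (FP.toℕ-inject≤ t m≤n)) (FP.toℕ<n t)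
      σ-inner-at : ∀ w → σ (inner t) w ≡ entry t w
      σ-inner-at w = trans (σ-inner t<m w) (cong (λ t′ → entry t′ w) (fromℕ<-inner t t<m))

  listRC-three : Fin (s F.zero) → Fin (s (F.suc F.zero)) → m ≤ n → ListRC G 3
  listRC-three a₀ b₀ m≤n L isList = c , c-isL , joins (IsPath G) geodesic⇒path c X-pairs Y-pairs
    where open Construction a₀ b₀ m≤n L isList

  listRC-root : ∀ {q} → Fin (s F.zero) → Fin (s (F.suc F.zero)) → (∀ i → s i ≤ n) → 2 ≤ n →
                IsCeilRoot m n q → ListRC G (q ⊓ 3)
  listRC-root {q} a₀ b₀ s≤n 2≤n root with q ≤? 3
  ... | yes q≤3 = subst (ListRC G) (sym (m≤n⇒m⊓n≡m q≤3)) (listSRC⇒listRC q (listSRC-root s≤n 2≤n root))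
  ... | no q≰3  = subst (ListRC G) (sym (m≥n⇒m⊓n≡n (<⇒≤ (≰⇒> q≰3))))
                    (listRC-three a₀ b₀ (<⇒≤ (<-trans (n<r^n (s≤s (s≤s z≤n)) m) (proj₂ root 3 (≰⇒> q≰3)))))

theorem3p14 : (k : ℕ) → 2 ≤ k → (ns : Fin (suc k) → ℕ) →
    ((i : Fin (suc k)) → 1 ≤ ns i) →
    ((i j : Fin (suc k)) → i F.≤ j → ns i ≤ ns j) →
    let G = CompleteMultipartite (suc k) ns
        m = sumFin k (λ i → ns (inject₁ i))
        n = ns (fromℕ k)
    in ((n ≡ 1 → rcℓ≡ G 1) × (2 ≤ n → n < m → rcℓ≡ G 2) × (m ≤ n → rcℓ≡ G (ceilRoot m n ⊓ 3)))
     × ((n ≡ 1 → srcℓ≡ G 1) × (2 ≤ n → n < m → srcℓ≡ G 2) × (m ≤ n → srcℓ≡ G (ceilRoot m n)))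
-- Each regime is governed by some q with IsCeilRoot m n q, namely 1, 2 and
-- ceilRoot m n; for the first two, q ⊓ 3 reduces to q.
theorem3p14 1 (s≤s ()) _ _ _
theorem3p14 (suc (suc k)) _ ns positive monotone =
  ( (λ n≡1 → rcℓ≡-root (root-1 n≡1) (listSRC⇒listRC 1 (singletons n≡1)))
  , (λ 2≤n n<m → rc (root-2 2≤n n<m) 2≤n)
  , (λ m≤n → rc root (≤-trans 2≤m m≤n)) )
  , ( (λ n≡1 → srcℓ≡-root w₀ (root-1 n≡1) (singletons n≡1))
  , (λ 2≤n n<m → src (root-2 2≤n n<m) 2≤n)
  , (λ m≤n → src root (≤-trans 2≤m m≤n)) )
  where
  open Multipartite (suc (suc k)) ns
  open ThreeColours k ns
  w₀ : W
  w₀ = F.zero , fromℕ< (positive F.zero)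
  s≤n : ∀ i → s i ≤ n
  s≤n i = monotone (inject₁ i) (fromℕ (suc (suc k))) (FP.≤fromℕ (inject₁ i))
  2≤m : 2 ≤ m
  2≤m = ≤-trans (s≤s (s≤s z≤n)) (k≤sumFin s (positive ∘ inject₁))
  root : IsCeilRoot m n (ceilRoot m n)
  root = ceilRoot-isCeilRoot n (<⇒≤ 2≤m)
  root-1 : n ≡ 1 → IsCeilRoot m n 1
  root-1 n≡1 = subst (λ n → IsCeilRoot m n 1) (sym n≡1) (isCeilRoot-1 {m} (<⇒≤ 2≤m))
  root-2 : 2 ≤ n → n < m → IsCeilRoot m n 2
  root-2 2≤n n<m = isCeilRoot-2 {m} 2≤n (<⇒≤ (<-trans n<m (n<r^n ≤-refl m)))
  singletons : n ≡ 1 → ListSRC G 1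
  singletons n≡1 = listSRC-singletons (λ c → subst (ns c ≤_) n≡1 (monotone c _ (FP.≤fromℕ c))) 1 ≤-refl
  src : ∀ {q} → IsCeilRoot m n q → 2 ≤ n → srcℓ≡ G q
  src root 2≤n = srcℓ≡-root w₀ root (listSRC-root s≤n 2≤n root)
  rc : ∀ {q} → IsCeilRoot m n q → 2 ≤ n → rcℓ≡ G (q ⊓ 3)
  rc root 2≤n = rcℓ≡-root root (listRC-root (proj₂ w₀) (fromℕ< (positive (F.suc F.zero))) s≤n 2≤n root)
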